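{- For every integer $\ell\geq3$ fix an admissible partition $\mathfrak{a}^\ell$ of $\ell$ such that, if $\ell\geq500$, then $c^{\mathfrak{a}^\ell}((a,b)^6)\geq\ell/200$ for all $(a,b)\in\{3,4,5\}^2$. For a $2$-regular graph $F$ and a finite sequence $x$, let $c^F(x)=\sum_{C}c^{\mathfrak{a}^{|C|}}(x)$, the sum over all cycles $C$ of $F$. Let $F$ be a $2$-regular graph on $n$ vertices. Then: (i) $c^F((a,b))=c^F((b,a))$ for all $a,b\in\{3,4,5\}$; (ii) $\sum_{a\in\{3,4,5\}}a\cdot c^F((a))=n$; (iii) for each $a\in\{3,4,5\}$, $c^F((a))=\sum_{b\in\{3,4,5\}}c^F((a,b))$; (iv) for every $\eta>0$, if at least $\eta n$ vertices of $F$ lie in cycles of length at least $500$, then $c^F((a,b)^6)\geq\eta n/200$ for all $(a,b)\in\{3,4,5\}^2$.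
   Context: A cyclic partition of $\ell$ is a tuple $(a_1,\dots,a_t)$ of positive integers summing to $\ell$, identified up to cyclic rotation, with indices modulo $t$; it is a cyclic $\{3,4,5\}$-partition if all $a_i\in\{3,4,5\}$. For a cyclic partition $\mathfrak{a}=(a_1,\dots,a_t)$ and a sequence $a'=(a'_1,\dots,a'_{t'})$, $c^{\mathfrak{a}}(a')$ is the number of $i\in[t]$ with $a_{i+j}=a'_j$ for all $j\in[t']$ (indices modulo $t$). A cyclic $\{3,4,5\}$-partition $\mathfrak a$ is admissible if $c^{\mathfrak a}((a,b))=c^{\mathfrak a}((b,a))$ for all $a,b\in\{3,4,5\}$. $x^m$ denotes the concatenation of $m$ copies of a sequence $x$. A $2$-regular graph is a vertex-disjoint union of cycles (each of length at least $3$).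
   Formalization: In item (iv), the parameter η ranges over the positive rationals. -}

module Defs where

open import Data.Nat using (ℕ; zero; suc; _+_; _*_; _≤_; _≡ᵇ_; _%_)
open import Data.Nat.Properties using (_≤?_)
open import Data.Bool using (Bool; true; false; _∧_; if_then_else_)
open import Data.Nat.ListAction using (sum)
open import Data.List using (List; []; _∷_; length; map; upTo; concat; replicate; filter; allFin)
open import Data.List.Relation.Unary.All using (All)
open import Data.List.Relation.Binary.Permutation.Propositional using (_↭_)
open import Data.Fin using (Fin)
open import Data.Sum using (_⊎_)
open import Data.Product using (_×_)
open import Relation.Binary.PropositionalEquality using (_≡_)

In345 : ℕ → Set
In345 a = a ≡ 3 ⊎ a ≡ 4 ⊎ a ≡ 5

-- k-th entry (0-based) of a list, 0 if out of range
nth : List ℕ → ℕ → ℕ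
nth []       _       = 0
nth (x ∷ xs) zero    = x
nth (x ∷ xs) (suc k) = nth xs k

cyc : List ℕ → ℕ → ℕ
cyc []       k = 0
cyc (x ∷ xs) k = nth (x ∷ xs) (k % suc (length xs))

matchFrom : List ℕ → ℕ → List ℕ → Bool
matchFrom a i []       = true
matchFrom a i (y ∷ ys) = (cyc a i ≡ᵇ y) ∧ matchFrom a (suc i) ys

count : List ℕ → List ℕ → ℕ
count a x = sum (map (λ i → if matchFrom a i x then 1 else 0) (upTo (length a)))

pow : List ℕ → ℕ → List ℕ
pow x m = concat (replicate m x)

-- cyclic {3,4,5}-partition of ℓ (tuple representative; c^a is rotation invariant)
IsCyclic345Partition : ℕ → List ℕ → Set
IsCyclic345Partition ℓ a = All In345 a × (sum a ≡ ℓ)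

Admissible : List ℕ → Set
Admissible a = ∀ p q → In345 p → In345 q → count a (p ∷ q ∷ []) ≡ count a (q ∷ p ∷ [])

-- A 2-regular graph on vertex set Fin n, given as a vertex-disjoint union of cycles
-- covering all vertices: each cycle is listed by its vertices in cyclic order,
-- has length ≥ 3, and the cycles partition the vertex set.
record TwoRegular (n : ℕ) : Set where
  field
    cycles    : List (List (Fin n))
    cycLength : All (λ C → 3 ≤ length C) cycles
    partition : concat cycles ↭ allFin n

cF : (ℕ → List ℕ) → ∀ {n} → TwoRegular n → List ℕ → ℕ
cF 𝔞 F x = sum (map (λ C → count (𝔞 (length C)) x) (TwoRegular.cycles F))

longVertices : ∀ {n} → TwoRegular n → ℕ
longVertices F = sum (map length (filter (λ C → 500 ≤? length C) (TwoRegular.cycles F)))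

module Submission where

-- Everything is linearity of finite sums.  c^𝔞(x) is a sum over positions of an
-- indicator, and c^F(x) is a sum over cycles of c^{𝔞^{|C|}}(x).  So
--   (i)   follows cycle by cycle from admissibility;
--   (ii)  follows from the pointwise identity Σ_a a·[a_i = a] = a_i, summed over
--         positions (giving ℓ = |C|) and then over cycles (giving n);
--   (iii) follows from [a_i = a] = Σ_b [a_i = a ∧ a_{i+1} = b], since a_{i+1} ∈ {3,4,5};
--   (iv)  follows from the per-cycle bound |C| ≤ 200·c(…) on long cycles, summed
--         over the long cycles, followed by a division by 200 in ℚ.

open import Defs
open import Data.Nat using (ℕ; _+_; _*_; _≤_)
open import Data.List using (List; []; _∷_)
open import Data.Product using (_×_)
open import Data.Integer using (+_)
open import Data.Rational using (ℚ; 0ℚ; _/_; _<_) renaming (_*_ to _*ℚ_; _≤_ to _≤ℚ_)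
open import Relation.Binary.PropositionalEquality using (_≡_)

open import Data.Nat using (zero; suc; _≡ᵇ_; z≤n; s≤s) renaming (_<_ to _<ℕ_)
import Data.Nat.Properties as ℕ
open import Data.Nat.DivMod using (m%n<n; m<n⇒m%n≡m)
open import Data.Nat.ListAction using (sum)
open import Data.Nat.Tactic.RingSolver using (solve)
import Data.Nat.Coprimality as Coprime
open import Algebra.Properties.CommutativeSemigroup ℕ.+-commutativeSemigroup using (interchange)
open import Data.Bool using (Bool; true; false; _∧_; if_then_else_)
open import Data.Sum using (inj₁; inj₂)
open import Data.Product using (_,_; proj₁; proj₂)
open import Data.Fin using (Fin)
open import Data.List using (length; map; upTo; applyUpTo; concat; filter)
open import Data.List.Properties using (map-cong-local; length-++; map-upTo; map-applyUpTo; length-tabulate)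
open import Data.List.Relation.Unary.All as All using (All)
open import Data.List.Relation.Unary.All.Properties using (all-upTo)
open import Data.List.Relation.Binary.Permutation.Propositional.Properties using (↭-length)
import Data.Integer as ℤ
import Data.Integer.Properties as ℤ
open import Data.Rational using (mkℚ; *≤*; NonNegative; toℚᵘ; fromℚᵘ)
import Data.Rational.Properties as ℚ
open import Data.Rational.Unnormalised as ℚᵘ using (mkℚᵘ; *≡*)
import Data.Rational.Unnormalised.Properties as ℚᵘ
open import Relation.Unary using (Decidable)
open import Relation.Nullary using (yes; no)
open import Relation.Binary.PropositionalEquality using (refl; sym; trans; cong; cong₂; subst₂; module ≡-Reasoning)

module _ {A : Set} where

  sum-map-cong : ∀ {P : A → Set} {f g : A → ℕ} {xs} → All P xs
    → (∀ {x} → P x → f x ≡ g x) → sum (map f xs) ≡ sum (map g xs)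
  sum-map-cong Pxs f≡g = cong sum (map-cong-local (All.map f≡g Pxs))

  sum-map-+ : ∀ (f g : A → ℕ) xs → sum (map (λ x → f x + g x) xs) ≡ sum (map f xs) + sum (map g xs)
  sum-map-+ f g []       = refl
  sum-map-+ f g (x ∷ xs) rewrite sum-map-+ f g xs = interchange (f x) (g x) _ _

  sum-map-+₃ : ∀ (f g h : A → ℕ) xs
    → sum (map (λ x → f x + g x + h x) xs) ≡ sum (map f xs) + sum (map g xs) + sum (map h xs)
  sum-map-+₃ f g h xs =
    trans (sum-map-+ (λ x → f x + g x) h xs) (cong (_+ sum (map h xs)) (sum-map-+ f g xs))

  sum-map-* : ∀ k (f : A → ℕ) xs → sum (map (λ x → k * f x) xs) ≡ k * sum (map f xs)
  sum-map-* k f []       = sym (ℕ.*-zeroʳ k)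
  sum-map-* k f (x ∷ xs) rewrite sum-map-* k f xs = sym (ℕ.*-distribˡ-+ k (f x) _)

  sum-map-linear : ∀ p q r (f g h : A → ℕ) xs
    → sum (map (λ x → p * f x + q * g x + r * h x) xs)
      ≡ p * sum (map f xs) + q * sum (map g xs) + r * sum (map h xs)
  sum-map-linear p q r f g h xs = begin
    sum (map (λ x → p * f x + q * g x + r * h x) xs)
      ≡⟨ sum-map-+₃ (λ x → p * f x) (λ x → q * g x) (λ x → r * h x) xs ⟩
    sum (map (λ x → p * f x) xs) + sum (map (λ x → q * g x) xs) + sum (map (λ x → r * h x) xs)
      ≡⟨ cong₂ _+_ (cong₂ _+_ (sum-map-* p f xs) (sum-map-* q g xs)) (sum-map-* r h xs) ⟩
    p * sum (map f xs) + q * sum (map g xs) + r * sum (map h xs) ∎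
    where open ≡-Reasoning

  sum-filter-≤ : ∀ {P : A → Set} (P? : Decidable P) (f g : A → ℕ)
    → (∀ x → P x → f x ≤ g x) → ∀ xs → sum (map f (filter P? xs)) ≤ sum (map g xs)
  sum-filter-≤ P? f g f≤g [] = z≤n
  sum-filter-≤ P? f g f≤g (x ∷ xs) with P? x
  ... | yes Px = ℕ.+-mono-≤ (f≤g x Px) (sum-filter-≤ P? f g f≤g xs)
  ... | no ¬Px = ℕ.≤-trans (sum-filter-≤ P? f g f≤g xs) (ℕ.m≤n+m _ (g x))

  sum-map-length : (xss : List (List A)) → sum (map length xss) ≡ length (concat xss)
  sum-map-length []         = refl
  sum-map-length (xs ∷ xss) = trans (cong (λ m → length xs + m) (sum-map-length xss)) (sym (length-++ xs))

indicator : Bool → ℕ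
indicator b = if b then 1 else 0

nth-All : ∀ {P : ℕ → Set} {a} → All P a → ∀ {i} → i <ℕ length a → P (nth a i)
nth-All (Px All.∷ _)   {zero}  _         = Px
nth-All (_  All.∷ Pxs) {suc i} (s≤s i<t) = nth-All Pxs i<t

cyc-All : ∀ {P : ℕ → Set} {x xs} → All P (x ∷ xs) → ∀ k → P (cyc (x ∷ xs) k)
cyc-All {xs = xs} Pa k = nth-All Pa (m%n<n k (suc (length xs)))

cyc-nth : ∀ a {i} → i <ℕ length a → cyc a i ≡ nth a i
cyc-nth (x ∷ xs) i<t = cong (nth (x ∷ xs)) (m<n⇒m%n≡m i<t)

sum-nth : ∀ a → sum (map (nth a) (upTo (length a))) ≡ sum a
sum-nth []       = refl
sum-nth (x ∷ xs) = cong (λ s → x + s) (begin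
  sum (map (nth (x ∷ xs)) (applyUpTo suc (length xs))) ≡⟨ cong sum (map-applyUpTo suc (nth (x ∷ xs)) (length xs)) ⟩
  sum (applyUpTo (nth xs) (length xs))                   ≡⟨ cong sum (map-upTo (nth xs) (length xs)) ⟨
  sum (map (nth xs) (upTo (length xs)))                  ≡⟨ sum-nth xs ⟩
  sum xs                                                 ∎)
  where open ≡-Reasoning

weigh-entry : ∀ v → In345 v
  → 3 * indicator ((v ≡ᵇ 3) ∧ true) + 4 * indicator ((v ≡ᵇ 4) ∧ true) + 5 * indicator ((v ≡ᵇ 5) ∧ true) ≡ v
weigh-entry _ (inj₁ refl)        = refl
weigh-entry _ (inj₂ (inj₁ refl)) = refl
weigh-entry _ (inj₂ (inj₂ refl)) = refl

split-by-next : ∀ b w → In345 w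
  → indicator (b ∧ true)
    ≡ indicator (b ∧ ((w ≡ᵇ 3) ∧ true)) + indicator (b ∧ ((w ≡ᵇ 4) ∧ true)) + indicator (b ∧ ((w ≡ᵇ 5) ∧ true))
split-by-next false _ _                  = refl
split-by-next true  _ (inj₁ refl)        = refl
split-by-next true  _ (inj₂ (inj₁ refl)) = refl
split-by-next true  _ (inj₂ (inj₂ refl)) = refl

count-weighted : ∀ a → All In345 a
  → 3 * count a (3 ∷ []) + 4 * count a (4 ∷ []) + 5 * count a (5 ∷ []) ≡ sum a
count-weighted a a∈345 = begin
  3 * count a (3 ∷ []) + 4 * count a (4 ∷ []) + 5 * count a (5 ∷ [])
    ≡⟨ sum-map-linear 3 4 5 (occurrence 3) (occurrence 4) (occurrence 5) positions ⟨
  sum (map (λ i → 3 * occurrence 3 i + 4 * occurrence 4 i + 5 * occurrence 5 i) positions)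
    ≡⟨ sum-map-cong (all-upTo (length a)) weigh-position ⟩
  sum (map (nth a) positions)
    ≡⟨ sum-nth a ⟩
  sum a ∎
  where
  open ≡-Reasoning
  positions : List ℕ
  positions = upTo (length a)
  occurrence : ℕ → ℕ → ℕ
  occurrence z i = indicator (matchFrom a i (z ∷ []))
  weigh-position : ∀ {i} → i <ℕ length a
    → 3 * occurrence 3 i + 4 * occurrence 4 i + 5 * occurrence 5 i ≡ nth a i
  weigh-position i<t rewrite cyc-nth a i<t = weigh-entry _ (nth-All a∈345 i<t)

count-extend : ∀ a → All In345 a → ∀ y
  → count a (y ∷ []) ≡ count a (y ∷ 3 ∷ []) + count a (y ∷ 4 ∷ []) + count a (y ∷ 5 ∷ [])
count-extend []         _      y = refl
count-extend a@(_ ∷ _)  a∈345 y = trans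
  (sum-map-cong (all-upTo (length a)) λ {i} _ → split-by-next (cyc a i ≡ᵇ y) (cyc a (suc i)) (cyc-All a∈345 (suc i)))
  (sum-map-+₃ (occurrence 3) (occurrence 4) (occurrence 5) (upTo (length a)))
  where
  occurrence : ℕ → ℕ → ℕ
  occurrence z i = indicator (matchFrom a i (y ∷ z ∷ []))

module _ (𝔞 : ℕ → List ℕ) {n} (F : TwoRegular n) where
  open TwoRegular F

  cycleCount : List ℕ → List (Fin n) → ℕ
  cycleCount x C = count (𝔞 (length C)) x

  vertex-count : sum (map length cycles) ≡ n
  vertex-count = trans (sum-map-length cycles) (trans (↭-length partition) (length-tabulate (λ v → v)))

  cF-symmetric : (∀ ℓ → 3 ≤ ℓ → Admissible (𝔞 ℓ))
    → ∀ a b → In345 a → In345 b → cF 𝔞 F (a ∷ b ∷ []) ≡ cF 𝔞 F (b ∷ a ∷ [])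
  cF-symmetric admissible a b a∈345 b∈345 =
    sum-map-cong cycLength (λ {C} 3≤|C| → admissible (length C) 3≤|C| a b a∈345 b∈345)

  cF-weighted : (∀ ℓ → 3 ≤ ℓ → IsCyclic345Partition ℓ (𝔞 ℓ))
    → 3 * cF 𝔞 F (3 ∷ []) + 4 * cF 𝔞 F (4 ∷ []) + 5 * cF 𝔞 F (5 ∷ []) ≡ n
  cF-weighted partitions = begin
    3 * cF 𝔞 F (3 ∷ []) + 4 * cF 𝔞 F (4 ∷ []) + 5 * cF 𝔞 F (5 ∷ [])
      ≡⟨ sum-map-linear 3 4 5 (cycleCount (3 ∷ [])) (cycleCount (4 ∷ [])) (cycleCount (5 ∷ [])) cycles ⟨
    sum (map (λ C → 3 * cycleCount (3 ∷ []) C + 4 * cycleCount (4 ∷ []) C + 5 * cycleCount (5 ∷ []) C) cycles)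
      ≡⟨ sum-map-cong cycLength (λ {C} → weigh-cycle {C}) ⟩
    sum (map length cycles)
      ≡⟨ vertex-count ⟩
    n ∎
    where
    open ≡-Reasoning
    weigh-cycle : ∀ {C} → 3 ≤ length C
      → 3 * cycleCount (3 ∷ []) C + 4 * cycleCount (4 ∷ []) C + 5 * cycleCount (5 ∷ []) C ≡ length C
    weigh-cycle {C} 3≤|C| with partitions (length C) 3≤|C|
    ... | entries∈345 , sum≡|C| = trans (count-weighted _ entries∈345) sum≡|C|

  cF-extend : (∀ ℓ → 3 ≤ ℓ → All In345 (𝔞 ℓ))
    → ∀ y → cF 𝔞 F (y ∷ []) ≡ cF 𝔞 F (y ∷ 3 ∷ []) + cF 𝔞 F (y ∷ 4 ∷ []) + cF 𝔞 F (y ∷ 5 ∷ [])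
  cF-extend entries∈345 y = trans
    (sum-map-cong cycLength (λ {C} 3≤|C| → count-extend _ (entries∈345 (length C) 3≤|C|) y))
    (sum-map-+₃ (cycleCount (y ∷ 3 ∷ [])) (cycleCount (y ∷ 4 ∷ [])) (cycleCount (y ∷ 5 ∷ [])) cycles)

  cF-long : ∀ k x → (∀ ℓ → 500 ≤ ℓ → ℓ ≤ k * count (𝔞 ℓ) x) → longVertices F ≤ k * cF 𝔞 F x
  cF-long k x long-bound = ℕ.≤-trans
    (sum-filter-≤ (λ C → 500 ℕ.≤? length C) length (λ C → k * cycleCount x C)
      (λ C → long-bound (length C)) cycles)
    (ℕ.≤-reflexive (sum-map-* k (cycleCount x) cycles))

ℕ/-cross : ∀ a b d e → a * suc e ≡ b * suc d → + a / suc d ≡ + b / suc e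
ℕ/-cross a b d e eq = ℚ.fromℚᵘ-cong {mkℚᵘ (+ a) d} {mkℚᵘ (+ b) e} (*≡* (begin
  + a ℤ.* + suc e   ≡⟨ ℤ.pos-* a (suc e) ⟨
  + (a * suc e)     ≡⟨ cong +_ eq ⟩
  + (b * suc d)     ≡⟨ ℤ.pos-* b (suc d) ⟩
  + b ℤ.* + suc d   ∎))
  where open ≡-Reasoning

ℕ/-* : ∀ a b d e → (+ a / suc d) *ℚ (+ b / suc e) ≡ + (a * b) / (suc d * suc e)
ℕ/-* a b d e = trans (sym (fromℚᵘ-* (mkℚᵘ (+ a) d) (mkℚᵘ (+ b) e))) (ℚ./-cong (sym (ℤ.pos-* a b)) refl)
  where
  fromℚᵘ-* : ∀ p q → fromℚᵘ (p ℚᵘ.* q) ≡ fromℚᵘ p *ℚ fromℚᵘ q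
  fromℚᵘ-* p q = ℚ.toℚᵘ-injective (begin
    toℚᵘ (fromℚᵘ (p ℚᵘ.* q))           ≈⟨ ℚ.toℚᵘ-fromℚᵘ (p ℚᵘ.* q) ⟩
    p ℚᵘ.* q                           ≈⟨ ℚᵘ.*-cong (ℚ.toℚᵘ-fromℚᵘ p) (ℚ.toℚᵘ-fromℚᵘ q) ⟨
    toℚᵘ (fromℚᵘ p) ℚᵘ.* toℚᵘ (fromℚᵘ q) ≈⟨ ℚ.toℚᵘ-homo-* (fromℚᵘ p) (fromℚᵘ q) ⟨
    toℚᵘ (fromℚᵘ p *ℚ fromℚᵘ q)        ∎)
    where open ℚᵘ.≃-Reasoning

ℕ/1-normal : ∀ m → + m / 1 ≡ mkℚ (+ m) 0 (Coprime.sym (Coprime.1-coprimeTo m))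
ℕ/1-normal m = ℚ.normalize-coprime (Coprime.sym (Coprime.1-coprimeTo m))

ℕ/1-mono-≤ : ∀ {a b} → a ≤ b → + a / 1 ≤ℚ + b / 1
ℕ/1-mono-≤ {a} {b} a≤b rewrite ℕ/1-normal a | ℕ/1-normal b =
  *≤* (subst₂ ℤ._≤_ (sym (ℤ.*-identityʳ (+ a))) (sym (ℤ.*-identityʳ (+ b))) (ℤ.+≤+ a≤b))

divide-bound : ∀ (η : ℚ) n L c k → η *ℚ (+ n / 1) ≤ℚ + L / 1 → L ≤ suc k * c
  → η *ℚ (+ n / suc k) ≤ℚ + c / 1
divide-bound η n L c k ηn≤L L≤kc = begin
  η *ℚ (+ n / suc k)               ≡⟨ cong (η *ℚ_) n/k≡n*r ⟩
  η *ℚ ((+ n / 1) *ℚ r)            ≡⟨ ℚ.*-assoc η (+ n / 1) r ⟨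
  (η *ℚ (+ n / 1)) *ℚ r            ≤⟨ ℚ.*-monoʳ-≤-nonNeg r ηn≤L ⟩
  (+ L / 1) *ℚ r                   ≤⟨ ℚ.*-monoʳ-≤-nonNeg r (ℕ/1-mono-≤ L≤kc) ⟩
  (+ (suc k * c) / 1) *ℚ r         ≡⟨ kc*r≡c ⟩
  + c / 1                          ∎
  where
  open ℚ.≤-Reasoning
  r : ℚ
  r = + 1 / suc k
  instance
    r-nonNeg : NonNegative r
    r-nonNeg = ℚ.normalize-nonNeg 1 (suc k)
  n/k≡n*r : + n / suc k ≡ (+ n / 1) *ℚ r
  n/k≡n*r = trans (ℕ/-cross n (n * 1) k _ (sym (ℕ.*-assoc n 1 (suc k)))) (sym (ℕ/-* n 1 0 k))
  kc*r≡c : (+ (suc k * c) / 1) *ℚ r ≡ + c / 1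
  kc*r≡c = trans (ℕ/-* (suc k * c) 1 0 k) (ℕ/-cross (suc k * c * 1) c (k + 0 * suc k) 0 (solve (k ∷ c ∷ [])))

-- The proposition.  Parts (iii) and (iv) hold more generally: (iii) for every a,
-- and (iv) for every rational η.
proposition4p3 : (𝔞 : ℕ → List ℕ)
    → (∀ ℓ → 3 ≤ ℓ → IsCyclic345Partition ℓ (𝔞 ℓ) × Admissible (𝔞 ℓ))
    → (∀ ℓ → 500 ≤ ℓ → ∀ a b → In345 a → In345 b → ℓ ≤ 200 * count (𝔞 ℓ) (pow (a ∷ b ∷ []) 6))
    → (n : ℕ) (F : TwoRegular n)
    → (∀ a b → In345 a → In345 b → cF 𝔞 F (a ∷ b ∷ []) ≡ cF 𝔞 F (b ∷ a ∷ []))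
      × (3 * cF 𝔞 F (3 ∷ []) + 4 * cF 𝔞 F (4 ∷ []) + 5 * cF 𝔞 F (5 ∷ []) ≡ n)
      × (∀ a → In345 a → cF 𝔞 F (a ∷ []) ≡ cF 𝔞 F (a ∷ 3 ∷ []) + cF 𝔞 F (a ∷ 4 ∷ []) + cF 𝔞 F (a ∷ 5 ∷ []))
      × (∀ (η : ℚ) → 0ℚ < η → η *ℚ (+ n / 1) ≤ℚ (+ longVertices F / 1)
          → ∀ a b → In345 a → In345 b → η *ℚ (+ n / 200) ≤ℚ (+ cF 𝔞 F (pow (a ∷ b ∷ []) 6) / 1))
proposition4p3 𝔞 partitions long-cycles n F =
    cF-symmetric 𝔞 F (λ ℓ 3≤ℓ → proj₂ (partitions ℓ 3≤ℓ))
  , cF-weighted 𝔞 F (λ ℓ 3≤ℓ → proj₁ (partitions ℓ 3≤ℓ))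
  , (λ a _ → cF-extend 𝔞 F (λ ℓ 3≤ℓ → proj₁ (proj₁ (partitions ℓ 3≤ℓ))) a)
  , λ η _ η-long a b a∈345 b∈345 →
      let xᵃᵇ = pow (a ∷ b ∷ []) 6
      in divide-bound η n (longVertices F) (cF 𝔞 F xᵃᵇ) 199 η-long
           (cF-long 𝔞 F 200 xᵃᵇ (λ ℓ 500≤ℓ → long-cycles ℓ 500≤ℓ a b a∈345 b∈345))
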